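{- Let $(P,\le)$ be a poset. Then the Heyting algebra $P^{+}$ of upsets of $P$ has a successor operation if and only if $(P,\le)$ satisfies the ascending chain condition.
   Context: $P^+$ is the set of upsets of $(P,\le)$; it is a Heyting algebra with $\cap,\cup,\emptyset,P$ and implication $U\Rightarrow V=(U\cap V^{c}]^{c}$, where $V^c=P\setminus V$ and $(Y]$ is the downset generated by $Y$. A successor operation on a Heyting algebra $H$ is a unary map $S$ such that for all $a,b\in H$: $a\le S(a)$, $S(a)\le b\vee(b\to a)$, and $S(a)\to a=a$. The ascending chain condition (ACC): every ascending sequence $x_1\le x_2\le\cdots$ in $P$ is eventually constant. -}

module Defs where

open import Level using (Level; _⊔_; suc)
open import Relation.Binary.Bundles using (Poset)
open import Relation.Unary using (Pred; _⊆_; _∩_; _∪_; ∅; U; _∈_; _∉_)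
open import Data.Product using (Σ; ∃; _×_; _,_)
open import Data.Nat using (ℕ; _≤_)
open import Relation.Nullary using (¬_)

module _ {c ℓ₁ ℓ₂ : Level} (P : Poset c ℓ₁ ℓ₂) where
  open Poset P renaming (Carrier to X; _≤_ to _⊑_; _≈_ to _≈ₚ_)

  lvl : Level
  lvl = c ⊔ ℓ₁ ⊔ ℓ₂

  record Upset : Set (suc lvl) where
    constructor upset
    field
      set : Pred X lvl
      up  : ∀ {x y} → x ⊑ y → x ∈ set → y ∈ set
  open Upset public

  _≤⁺_ : Upset → Upset → Set lvl
  A ≤⁺ B = set A ⊆ set B

  _≐⁺_ : Upset → Upset → Set lvl
  A ≐⁺ B = (A ≤⁺ B) × (B ≤⁺ A)

  _∨⁺_ : Upset → Upset → Upset
  A ∨⁺ B = upset (set A ∪ set B) λ { x≤y (Data.Sum.inj₁ a) → Data.Sum.inj₁ (up A x≤y a)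
                                    ; x≤y (Data.Sum.inj₂ b) → Data.Sum.inj₂ (up B x≤y b) }
    where import Data.Sum

  compl : Pred X lvl → Pred X lvl
  compl V x = x ∉ V

  down : Pred X lvl → Pred X lvl
  down Y x = ∃ λ y → x ⊑ y × y ∈ Y

  _⇒⁺_ : Upset → Upset → Upset
  A ⇒⁺ B = upset (compl (down (set A ∩ compl (set B))))
                 (λ x≤y ¬d (z , y≤z , h) → ¬d (z , trans x≤y y≤z , h))

  -- successor operation on the Heyting algebra P⁺ (a function on the set of
  -- upsets, hence required to respect extensional equality of upsets)
  record IsSuccessor (S : Upset → Upset) : Set (suc lvl) where
    field
      S-cong : ∀ {A B} → A ≐⁺ B → S A ≐⁺ S B
      S-infl : ∀ A → A ≤⁺ S A
      S-le   : ∀ A B → S A ≤⁺ (B ∨⁺ (B ⇒⁺ A))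
      S-imp  : ∀ A → (S A ⇒⁺ A) ≐⁺ A

  HasSuccessor : Set (suc lvl)
  HasSuccessor = Σ (Upset → Upset) IsSuccessor

  ACC : Set (c ⊔ ℓ₁ ⊔ ℓ₂)
  ACC = (x : ℕ → X) → (∀ n → x n ⊑ x (Data.Nat.suc n)) →
        ∃ λ N → ∀ n → N ≤ n → x n ≈ₚ x N
    where import Data.Nat

module Submission where

-- (⇐) Put  S(A) = { x | every y strictly above x lies in A }.  This is an
-- upset containing A, and S(A) ≤ B ∨ (B ⇒ A) holds in any poset.  The
-- remaining law (S(A) ⇒ A) = A is where ACC enters: under ACC every nonempty
-- set of points has a maximal element, and a maximal point z above x outside
-- A lies in S(A) ∖ A, witnessing that x ∉ S(A) ⇒ A.
--
-- (⇒) Conversely, for any successor S, a point of S(A) ∖ A is maximal in the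
-- complement of A (test the law S(A) ≤ B ∨ (B ⇒ A) with B = ↑y).  Given an
-- ascending chain, let U be the set of points below no member of it.  The
-- law (S(U) ⇒ U) = U places some z ≥ x₀ in S(U) ∖ U; z lies below some xₘ,
-- and maximality of z forces xₙ ≤ z ≤ xₘ ≤ xₙ for all n ≥ m.

open import Defs
open import Level using (Level; _⊔_; Lift; lift; lower)
open import Relation.Binary.Bundles using (Poset)
open import Axiom.ExcludedMiddle using (ExcludedMiddle)
open import Function.Bundles using (_⇔_; mk⇔)
open import Data.Product using (Σ; ∃; _×_; _,_; proj₁; proj₂)
open import Data.Sum using (inj₁; inj₂)
open import Data.Nat using (ℕ; zero; suc; _≤_; _≤′_; ≤′-refl; ≤′-step)
open import Data.Nat.Properties using (≤⇒≤′; n≤1+n)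
open import Relation.Nullary using (¬_; yes; no)
open import Relation.Nullary.Decidable using (decidable-stable)
open import Relation.Unary using (Pred; _⊆_)

module Upsets {c ℓ₁ ℓ₂} (P : Poset c ℓ₁ ℓ₂) where
  open Poset P renaming (Carrier to X; _≤_ to _⊑_; _≈_ to _≈ₚ_)

  L : Level
  L = lvl P

  _⊏_ : X → X → Set ℓ₂
  x ⊏ y = x ⊑ y × ¬ y ⊑ x

  Maximal : Pred X L → X → Set L
  Maximal Q z = Q z × (∀ y → z ⊏ y → ¬ Q y)

  ascending-mono : (x : ℕ → X) → (∀ n → x n ⊑ x (suc n)) →
                   ∀ {m n} → m ≤′ n → x m ⊑ x n
  ascending-mono x asc ≤′-refl      = refl
  ascending-mono x asc (≤′-step m≤n) = trans (ascending-mono x asc m≤n) (asc _)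

  acc⇒no-strict-chain : ACC P → (s : ℕ → X) → ¬ (∀ n → s n ⊏ s (suc n))
  acc⇒no-strict-chain acc s strict with acc s (λ n → proj₁ (strict n))
  ... | N , stable = proj₂ (strict N) (reflexive (stable (suc N) (n≤1+n N)))

  principal : X → Upset P
  principal y = upset (λ p → Lift L (y ⊑ p)) (λ p⊑q (lift y⊑p) → lift (trans y⊑p p⊑q))

  -- In every successor operation, points of S(A) ∖ A are maximal outside A:
  -- test S(A) ≤ B ∨ (B ⇒ A) with B = ↑y.
  successor-maximal : ∀ {S} → IsSuccessor P S → ∀ A {z} → set (S A) z → ¬ set A z →
                      ∀ y → z ⊏ y → ¬ ¬ set A y
  successor-maximal isS A z∈SA z∉A y (z⊑y , y⋢z) y∉A
    with IsSuccessor.S-le isS A (principal y) z∈SA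
  ... | inj₁ (lift y⊑z) = y⋢z y⊑z
  ... | inj₂ z∈↑y⇒A     = z∈↑y⇒A (y , z⊑y , lift refl , y∉A)

  succ⁺ : Upset P → Upset P
  succ⁺ A = upset (λ x → ∀ y → x ⊏ y → set A y)
    (λ x⊑x′ h y (x′⊑y , y⋢x′) → h y (trans x⊑x′ x′⊑y , λ y⊑x → y⋢x′ (trans y⊑x x⊑x′)))

  succ⁺-infl : ∀ A → set A ⊆ set (succ⁺ A)
  succ⁺-infl A x∈A y (x⊑y , _) = up A x⊑y x∈A

  -- If x ∉ B and y ∈ B with x ⊑ y, then y is strictly above x, so y ∈ A.
  succ⁺-le-impl : ∀ A B {x} → set (succ⁺ A) x → ¬ set B x → set (_⇒⁺_ P B A) x
  succ⁺-le-impl A B {x} x∈SA x∉B (y , x⊑y , y∈B , y∉A) =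
    y∉A (x∈SA y (x⊑y , λ y⊑x → x∉B (up B y⊑x y∈B)))

  module Classical (em : ExcludedMiddle (lvl P)) where

    dne : {Q : Set L} → ¬ ¬ Q → Q
    dne = decidable-stable em

    dne₂ : {Q : Set ℓ₂} → ¬ ¬ Q → Q
    dne₂ nnq = lower (dne {Lift L _} (λ ¬lq → nnq (λ q → ¬lq (lift q))))

    succ⁺-le : ∀ A B → set (succ⁺ A) ⊆ set (_∨⁺_ P B (_⇒⁺_ P B A))
    succ⁺-le A B {x} x∈SA with em {set B x}
    ... | yes x∈B = inj₁ x∈B
    ... | no  x∉B = inj₂ (succ⁺-le-impl A B x∈SA x∉B)

    -- Under ACC every nonempty set of points has a maximal element: otherwise
    -- one could step strictly upward forever.
    acc⇒maximal : ACC P → (Q : Pred X L) → ∀ {x} → Q x → ∃ (Maximal Q)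
    acc⇒maximal acc Q {x} Qx = dne λ no-max →
        acc⇒no-strict-chain acc (λ n → proj₁ (walk no-max n))
                                (λ n → proj₁ (proj₂ (next no-max (walk no-max n))))
      where
      next : ¬ ∃ (Maximal Q) → (s : Σ X Q) → Σ X λ y → proj₁ s ⊏ y × Q y
      next no-max (z , Qz) = dne λ no-step →
        no-max (z , Qz , λ y z⊏y Qy → no-step (y , z⊏y , Qy))

      walk : ¬ ∃ (Maximal Q) → ℕ → Σ X Q
      walk no-max zero    = x , Qx
      walk no-max (suc n) = let s = next no-max (walk no-max n)
                            in proj₁ s , proj₂ (proj₂ s)

    -- Under ACC, (S(A) ⇒ A) ⊆ A: a maximal point above x outside A would lie
    -- in S(A) ∖ A.
    succ⁺-imp : ACC P → ∀ A → set (_⇒⁺_ P (succ⁺ A) A) ⊆ set A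
    succ⁺-imp acc A {x} x∈SA⇒A = dne λ x∉A →
      let Q = λ z → x ⊑ z × ¬ set A z
          (z , (x⊑z , z∉A) , z-max) = acc⇒maximal acc Q (refl , x∉A)
          z∈SA : set (succ⁺ A) z
          z∈SA y (z⊑y , y⋢z) = dne λ y∉A →
            z-max y (z⊑y , y⋢z) (trans x⊑z z⊑y , y∉A)
      in x∈SA⇒A (z , x⊑z , z∈SA , z∉A)

    acc⇒successor : ACC P → HasSuccessor P
    acc⇒successor acc = succ⁺ , record
      { S-cong = λ (A⊆B , B⊆A) → (λ h y x⊏y → A⊆B (h y x⊏y)) , (λ h y x⊏y → B⊆A (h y x⊏y))
      ; S-infl = succ⁺-infl
      ; S-le   = succ⁺-le
      ; S-imp  = λ A → succ⁺-imp acc A , λ x∈A (z , x⊑z , _ , z∉A) → z∉A (up A x⊑z x∈A)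
      }

    -- (⇒): given an ascending chain x, the points below no xₙ form an upset U;
    -- a point z ≥ x₀ of S(U) ∖ U sits below some xₘ and bounds every later xₙ.
    successor⇒acc : HasSuccessor P → ACC P
    successor⇒acc (S , isS) x asc = m , stabilises
      where
      U : Upset P
      U = upset (λ p → ¬ Lift L (∃ λ n → p ⊑ x n))
                (λ p⊑q q∉↓x (lift (n , p⊑xn)) → q∉↓x (lift (n , trans p⊑q p⊑xn)))

      xₙ∉U : ∀ n → ¬ set U (x n)
      xₙ∉U n xₙ∈U = xₙ∈U (lift (n , refl))

      -- x₀ ∉ U = (S(U) ⇒ U), so x₀ lies below a point of S(U) ∖ U
      witness : down P (λ p → set (S U) p × ¬ set U p) (x 0)
      witness = dne λ x₀∈SU⇒U → xₙ∉U 0 (proj₁ (IsSuccessor.S-imp isS U) x₀∈SU⇒U)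

      z : X
      z = proj₁ witness

      z∈SU : set (S U) z
      z∈SU = proj₁ (proj₂ (proj₂ witness))

      z∉U : ¬ set U z
      z∉U = proj₂ (proj₂ (proj₂ witness))

      below : ∃ λ m → z ⊑ x m
      below = dne₂ λ not-below → z∉U λ (lift b) → not-below b

      m : ℕ
      m = proj₁ below

      stabilises : ∀ n → m ≤ n → x n ≈ₚ x m
      stabilises n m≤n = antisym (trans xₙ⊑z (proj₂ below)) xₘ⊑xₙ
        where
        xₘ⊑xₙ : x m ⊑ x n
        xₘ⊑xₙ = ascending-mono x asc (≤⇒≤′ m≤n)

        -- x n is not strictly above z, since it lies outside U
        xₙ⊑z : x n ⊑ z
        xₙ⊑z = dne₂ λ xₙ⋢z →
          successor-maximal isS U z∈SU z∉U (x n) (trans (proj₂ below) xₘ⊑xₙ , xₙ⋢z) (xₙ∉U n)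

theorem5p1 : ∀ {c ℓ₁ ℓ₂} (P : Poset c ℓ₁ ℓ₂) → ExcludedMiddle (c ⊔ ℓ₁ ⊔ ℓ₂) →
    HasSuccessor P ⇔ ACC P
theorem5p1 P em = mk⇔ successor⇒acc acc⇒successor
  where open Upsets.Classical P em
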